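{- Let a trace monoid $\mathcal{M}=\mathcal{M}(\Sigma,I)$ act partially on a finite set $X_0$. For $\alpha\in X_0$ let $t_\alpha$ be the radius of convergence of $Z_\alpha(t)=\sum_{x\in\mathcal{M}_\alpha}t^{|x|}$. If $\alpha\Rightarrow\beta$ then $t_\alpha\le t_\beta$.
   Context: Trace monoid: $\Sigma$ finite, $|\Sigma|\ge2$, $I$ irreflexive symmetric, $\mathcal{M}=\Sigma^*/\langle ab=ba,(a,b)\in I\rangle$, unit $1$, length $|x|$; $a\parallel b$ iff $(a,b)\in I$. A partial action: nonempty $\Sigma(\alpha)\subseteq\Sigma$ for $\alpha\in X_0$ and maps $a\in\Sigma(\alpha)\mapsto\alpha\cdot a\in X_0$ such that if $a\in\Sigma(\alpha)$ and $a\parallel b$, then either $b\in\Sigma(\alpha)$ and $a\in\Sigma(\alpha\cdot b)$, $b\in\Sigma(\alpha\cdot a)$, $(\alpha\cdot a)\cdot b=(\alpha\cdot b)\cdot a$; or $b\notin\Sigma(\alpha)$ and $b\notin\Sigma(\alpha\cdot a)$. The total action is the unique right action on $X_0\cup\{\bot\}$ extending these maps with $\alpha\cdot a=\bot$ for $a\notin\Sigma(\alpha)$, $\bot\cdot a=\bot$. $\mathcal{M}_\alpha=\{x:\alpha\cdot x\ne\bot\}$. $\alpha\Rightarrow\beta$ means $\alpha\cdot x=\beta$ for some trace $x\neq1$. -}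

module Defs where

open import Data.Nat using (ℕ; zero; suc)
open import Data.Fin using (Fin)
open import Data.Bool using (Bool; true; false)
open import Data.List using (List; []; _∷_; _++_; length; map; foldr)
open import Data.Maybe using (Maybe; just; nothing)
open import Data.Product using (Σ; ∃; ∃-syntax; _×_; _,_)
open import Data.Sum using (_⊎_)
open import Data.Rational using (ℚ; 0ℚ; 1ℚ; _*_; _+_; _≤_; _<_)
open import Relation.Binary.PropositionalEquality using (_≡_; _≢_)
open import Relation.Nullary using (¬_)
open import Data.List.Relation.Unary.All using (All)
open import Data.List.Relation.Unary.AllPairs using (AllPairs)
open import Relation.Binary.Construct.Closure.Equivalence using (EqClosure)

record IndepAlphabet : Set where
  field
    k      : ℕ
    two≤k  : Data.Nat._≤_ 2 k
    I      : Fin k → Fin k → Bool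
    irrefl : ∀ a → I a a ≡ false
    sym    : ∀ a b → I a b ≡ I b a

module _ (A : IndepAlphabet) where
  open IndepAlphabet A

  Letter : Set
  Letter = Fin k

  _∥_ : Letter → Letter → Set
  a ∥ b = I a b ≡ true

  Word : Set
  Word = List Letter

  data Swap : Word → Word → Set where
    swap : ∀ (u v : Word) (a b : Letter) → a ∥ b →
           Swap (u ++ (a ∷ b ∷ v)) (u ++ (b ∷ a ∷ v))

  -- Traces (elements of M(Σ,I)) are words up to _~_ ; the unit 1 is the
  -- class of [], and |x| is the length of any representative.
  _~_ : Word → Word → Set
  _~_ = EqClosure Swap

  -- Partial action on a finite set X₀ = Fin n.
  -- step α a = just (α · a) if a ∈ Σ(α), and nothing otherwise
  -- (nothing plays the role of ⊥).

  record PartialAction (n : ℕ) : Set where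
    field
      step     : Fin n → Letter → Maybe (Fin n)
      nonempty : ∀ α → ∃[ a ] ∃[ γ ] step α a ≡ just γ
      coherent : ∀ α a b γ → step α a ≡ just γ → a ∥ b →
                   (∃[ δ ] ∃[ ε ] (step α b ≡ just δ × step γ b ≡ just ε
                                    × step δ a ≡ just ε))
                 ⊎ (step α b ≡ nothing × step γ b ≡ nothing)

  module _ {n : ℕ} (P : PartialAction n) where
    open PartialAction P

    act₁ : Maybe (Fin n) → Letter → Maybe (Fin n)
    act₁ (just α) a = step α a
    act₁ nothing  a = nothing

    -- total right action of words (it is invariant under _~_, so it is
    -- the action of traces)
    act : Maybe (Fin n) → Word → Maybe (Fin n)
    act s []       = s
    act s (a ∷ w)  = act (act₁ s a) w

    InM : Fin n → Word → Set
    InM α x = act (just α) x ≢ nothing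

    _⇒_ : Fin n → Fin n → Set
    α ⇒ β = ∃[ x ] (x ≢ [] × act (just α) x ≡ just β)

    -- Z_α(q) = Σ_{x ∈ M_α} q^{|x|} for rational q ≥ 0, as a sum of
    -- non-negative terms indexed by the traces in M_α: it is finite iff
    -- the sums over all finite sets of traces in M_α (= finite lists of
    -- pairwise non-equivalent words in M_α) are bounded.

    _^ℚ_ : ℚ → ℕ → ℚ
    q ^ℚ zero  = 1ℚ
    q ^ℚ suc m = q * (q ^ℚ m)

    sumℚ : List ℚ → ℚ
    sumℚ = foldr _+_ 0ℚ

    ZFinite : Fin n → ℚ → Set
    ZFinite α q = ∃[ B ] ∀ (xs : List Word) →
                    AllPairs (λ u v → ¬ (u ~ v)) xs →
                    All (InM α) xs →
                    sumℚ (map (λ x → q ^ℚ length x) xs) ≤ B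

    -- The radius t_α is the supremum of the (down-closed) set of
    -- q ≥ 0 with Z_α(q) < ∞; for rational q this set is dense enough, so
    --   t_α ≤ t_β  iff  whenever Z_α(q) < ∞ and 0 ≤ p < q, Z_β(p) < ∞.
    RadiusLe : Fin n → Fin n → Set
    RadiusLe α β = ∀ (p q : ℚ) → 0ℚ ≤ p → p < q →
                     ZFinite α q → ZFinite β p

{-# OPTIONS --safe #-}
-- If α · x = β, then y ↦ x y maps M_β injectively into M_α (trace monoids are
-- left cancellative) with |x y| = |x| + |y|, so q^|x| Z_β(q) ≤ Z_α(q) for q > 0.
-- Hence Z_β converges wherever Z_α does, and convergence passes down to smaller
-- arguments because Z_β has non-negative coefficients.  Left cancellation holds
-- because deleting the first occurrence of a letter a respects every commutation
-- b c = c b (b ∥ c forces b ≠ c, so a cannot be both letters).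
module Submission where

open import Defs
open import Data.Nat using (ℕ)
open import Data.Nat as Nat using (zero; suc)
open import Data.Fin using (Fin)

open import Algebra.Bundles using (Ring)
open import Data.Empty using (⊥-elim)
open import Data.Fin.Properties using (_≟_)
open import Data.List using (List; []; _∷_; _++_; length; map; foldr)
open import Data.List.Properties using (length-++; map-∘; map-cong)
open import Data.List.Relation.Unary.All as All using ()
open import Data.List.Relation.Unary.All.Properties as All using ()
open import Data.List.Relation.Unary.AllPairs as AllPairs using ()
open import Data.List.Relation.Unary.AllPairs.Properties as AllPairs using ()
open import Data.Maybe using (just)
open import Data.Product using (_,_)
open import Data.Rational
  using (ℚ; 0ℚ; 1ℚ; _+_; _*_; _≤_; 1/_; Positive; NonZero; positive; nonNegative)
open import Data.Rational.Properties as ℚ using ()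
open import Function using (_∘_)
open import Relation.Binary.Construct.Closure.Equivalence as EqClosure using ()
open import Relation.Binary.Construct.Closure.Reflexive as ReflClosure
  using (ReflClosure; refl; [_])
open import Relation.Binary.PropositionalEquality
  using (_≡_; _≢_; refl; sym; trans; cong; cong₂; subst; subst₂; module ≡-Reasoning)
open import Relation.Nullary using (¬_; yes; no)

open import Algebra.Definitions.RawSemiring ℚ.+-*-rawSemiring using (_^_)
open import Algebra.Properties.Semiring.Exp (Ring.semiring ℚ.+-*-ring) using (^-homo-*)

^-pos : ∀ {q} m → Positive q → Positive (q ^ m)
^-pos zero    q>0 = _
^-pos {q} (suc m) q>0 = ℚ.pos*pos⇒pos q {{q>0}} (q ^ m) {{^-pos m q>0}}

^-nonNeg : ∀ {q} m → 0ℚ ≤ q → 0ℚ ≤ q ^ m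
^-nonNeg zero    0≤q = ℚ.<⇒≤ (ℚ.positive⁻¹ 1ℚ)
^-nonNeg {q} (suc m) 0≤q = ℚ.nonNegative⁻¹ (q * q ^ m)
  {{ℚ.nonNeg*nonNeg⇒nonNeg q {{nonNegative 0≤q}} (q ^ m) {{nonNegative (^-nonNeg m 0≤q)}}}}

^-monoˡ-≤-nonNeg : ∀ {p q} m → 0ℚ ≤ p → p ≤ q → p ^ m ≤ q ^ m
^-monoˡ-≤-nonNeg zero    0≤p p≤q = ℚ.≤-refl
^-monoˡ-≤-nonNeg {p} {q} (suc m) 0≤p p≤q = ℚ.≤-trans
  (ℚ.*-monoˡ-≤-nonNeg p {{nonNegative 0≤p}} (^-monoˡ-≤-nonNeg m 0≤p p≤q))
  (ℚ.*-monoʳ-≤-nonNeg (q ^ m) {{nonNegative (^-nonNeg m (ℚ.≤-trans 0≤p p≤q))}} p≤q)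

sum : List ℚ → ℚ
sum = foldr _+_ 0ℚ

sum-*ˡ : ∀ c xs → sum (map (c *_) xs) ≡ c * sum xs
sum-*ˡ c []       = sym (ℚ.*-zeroʳ c)
sum-*ˡ c (x ∷ xs) = trans (cong (c * x +_) (sum-*ˡ c xs)) (sym (ℚ.*-distribˡ-+ c x (sum xs)))

sum-map-mono-≤ : ∀ {A : Set} {f g : A → ℚ} → (∀ x → f x ≤ g x) →
                 ∀ xs → sum (map f xs) ≤ sum (map g xs)
sum-map-mono-≤ f≤g []       = ℚ.≤-refl
sum-map-mono-≤ f≤g (x ∷ xs) = ℚ.+-mono-≤ (f≤g x) (sum-map-mono-≤ f≤g xs)

*-≤⇒≤-1/*ˡ : ∀ c {{_ : Positive c}} {x B} →
             c * x ≤ B → x ≤ (1/ c) {{ℚ.pos⇒nonZero c}} * B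
*-≤⇒≤-1/*ˡ c {x} {B} cx≤B = ℚ.*-cancelˡ-≤-pos c (subst (c * x ≤_) B≡c*[1/c*B] cx≤B)
  where
  instance
    c≢0 : NonZero c
    c≢0 = ℚ.pos⇒nonZero c
  B≡c*[1/c*B] : B ≡ c * ((1/ c) * B)
  B≡c*[1/c*B] = begin
    B                  ≡⟨ sym (ℚ.*-identityˡ B) ⟩
    1ℚ * B             ≡⟨ cong (_* B) (sym (ℚ.*-inverseʳ c)) ⟩
    (c * (1/ c)) * B   ≡⟨ ℚ.*-assoc c (1/ c) B ⟩
    c * ((1/ c) * B)   ∎
    where open ≡-Reasoning

module _ (A : IndepAlphabet) where
  open IndepAlphabet A using (irrefl)

  ∥-irrefl : ∀ {a} → ¬ _∥_ A a a
  ∥-irrefl {a} a∥a with () ← trans (sym a∥a) (irrefl a)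

  deleteFirst : Letter A → Word A → Word A
  deleteFirst a []      = []
  deleteFirst a (b ∷ w) with a ≟ b
  ... | yes _ = w
  ... | no  _ = b ∷ deleteFirst a w

  deleteFirst-head : ∀ a w → deleteFirst a (a ∷ w) ≡ w
  deleteFirst-head a w with a ≟ a
  ... | yes _   = refl
  ... | no  a≢a = ⊥-elim (a≢a refl)

  Swap-∷ : ∀ a {w w′} → Swap A w w′ → Swap A (a ∷ w) (a ∷ w′)
  Swap-∷ a (swap u v b c b∥c) = swap (a ∷ u) v b c b∥c

  deleteFirst-∷-≢ : ∀ {a b} w → a ≢ b → deleteFirst a (b ∷ w) ≡ b ∷ deleteFirst a w
  deleteFirst-∷-≢ {a} {b} w a≢b with a ≟ b
  ... | yes a≡b = ⊥-elim (a≢b a≡b)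
  ... | no  _   = refl

  deleteFirst-swap-head : ∀ a {b c} v → _∥_ A b c →
    ReflClosure (Swap A) (deleteFirst a (b ∷ c ∷ v)) (deleteFirst a (c ∷ b ∷ v))
  deleteFirst-swap-head a {b} {c} v b∥c with a ≟ b | a ≟ c
  ... | yes refl | yes refl = ⊥-elim (∥-irrefl b∥c)
  ... | yes refl | no  a≢c  rewrite deleteFirst-head a v = refl
  ... | no  a≢b  | yes refl rewrite deleteFirst-head a v = refl
  ... | no  a≢b  | no  a≢c  rewrite deleteFirst-∷-≢ v a≢b | deleteFirst-∷-≢ v a≢c =
    [ swap [] (deleteFirst a v) b c b∥c ]

  deleteFirst-swap : ∀ a u v {b c} → _∥_ A b c →
    ReflClosure (Swap A) (deleteFirst a (u ++ b ∷ c ∷ v)) (deleteFirst a (u ++ c ∷ b ∷ v))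
  deleteFirst-swap a []      v b∥c = deleteFirst-swap-head a v b∥c
  deleteFirst-swap a (d ∷ u) v b∥c with a ≟ d
  ... | yes refl = [ swap u v _ _ b∥c ]
  ... | no  _    = ReflClosure.map (Swap-∷ d) (deleteFirst-swap a u v b∥c)

  deleteFirst-Swap : ∀ a {w w′} → Swap A w w′ →
                     ReflClosure (Swap A) (deleteFirst a w) (deleteFirst a w′)
  deleteFirst-Swap a (swap u v b c b∥c) = deleteFirst-swap a u v b∥c

  deleteFirst-~ : ∀ a {w w′} → _~_ A w w′ → _~_ A (deleteFirst a w) (deleteFirst a w′)
  deleteFirst-~ a = EqClosure.gfold (EqClosure.isEquivalence (Swap A)) (deleteFirst a)
    λ s → ReflClosure.drop-refl {R = _~_ A} (EqClosure.reflexive (Swap A))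
            (ReflClosure.map EqClosure.return (deleteFirst-Swap a s))

  ∷-cancelˡ-~ : ∀ a {u v} → _~_ A (a ∷ u) (a ∷ v) → _~_ A u v
  ∷-cancelˡ-~ a {u} {v} e =
    subst₂ (_~_ A) (deleteFirst-head a u) (deleteFirst-head a v) (deleteFirst-~ a e)

  ++-cancelˡ-~ : ∀ x {u v} → _~_ A (x ++ u) (x ++ v) → _~_ A u v
  ++-cancelˡ-~ []      e = e
  ++-cancelˡ-~ (a ∷ x) e = ++-cancelˡ-~ x (∷-cancelˡ-~ a e)

module _ (A : IndepAlphabet) {n : ℕ} (P : PartialAction A n) where

  act-++ : ∀ s x y → act A P s (x ++ y) ≡ act A P (act A P s x) y
  act-++ s []      y = refl
  act-++ s (a ∷ x) y = act-++ (act₁ A P s a) x y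

  InM-++ : ∀ {α β} x {y} → act A P (just α) x ≡ just β → InM A P β y → InM A P α (x ++ y)
  InM-++ {α} x {y} αx≡β βy≢⊥ αxy≡⊥ =
    βy≢⊥ (trans (cong (λ s → act A P s y) (sym αx≡β)) (trans (sym (act-++ (just α) x y)) αxy≡⊥))

  ^ℚ≡^ : ∀ q m → _^ℚ_ A P q m ≡ q ^ m
  ^ℚ≡^ q zero    = refl
  ^ℚ≡^ q (suc m) = cong (q *_) (^ℚ≡^ q m)

  weight : ℚ → Word A → ℚ
  weight q x = _^ℚ_ A P q (length x)

  weight-++ : ∀ q x y → weight q (x ++ y) ≡ weight q x * weight q y
  weight-++ q x y = begin
    _^ℚ_ A P q (length (x ++ y))   ≡⟨ ^ℚ≡^ q (length (x ++ y)) ⟩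
    q ^ length (x ++ y)            ≡⟨ cong (q ^_) (length-++ x) ⟩
    q ^ (length x Nat.+ length y)  ≡⟨ ^-homo-* q (length x) (length y) ⟩
    q ^ length x * q ^ length y    ≡⟨ sym (cong₂ _*_ (^ℚ≡^ q (length x)) (^ℚ≡^ q (length y))) ⟩
    weight q x * weight q y        ∎
    where open ≡-Reasoning

  weight-monoˡ-≤ : ∀ {p q} x → 0ℚ ≤ p → p ≤ q → weight p x ≤ weight q x
  weight-monoˡ-≤ {p} {q} x 0≤p p≤q =
    subst₂ _≤_ (sym (^ℚ≡^ p (length x))) (sym (^ℚ≡^ q (length x)))
      (^-monoˡ-≤-nonNeg (length x) 0≤p p≤q)

  sum-weights-++ : ∀ q x ys →
    sum (map (weight q) (map (x ++_) ys)) ≡ weight q x * sum (map (weight q) ys)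
  sum-weights-++ q x ys = begin
    sum (map (weight q) (map (x ++_) ys))          ≡⟨ cong sum (sym (map-∘ ys)) ⟩
    sum (map (weight q ∘ (x ++_)) ys)              ≡⟨ cong sum (map-cong (weight-++ q x) ys) ⟩
    sum (map ((weight q x *_) ∘ weight q) ys)      ≡⟨ cong sum (map-∘ ys) ⟩
    sum (map (weight q x *_) (map (weight q) ys))  ≡⟨ sum-*ˡ (weight q x) (map (weight q) ys) ⟩
    weight q x * sum (map (weight q) ys)           ∎
    where open ≡-Reasoning

  ZFinite-antimono : ∀ {β p q} → 0ℚ ≤ p → p ≤ q → ZFinite A P β q → ZFinite A P β p
  ZFinite-antimono 0≤p p≤q (B , Zq≤B) = B , λ ys distinct inM →
    ℚ.≤-trans (sum-map-mono-≤ (λ y → weight-monoˡ-≤ y 0≤p p≤q) ys) (Zq≤B ys distinct inM)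

  ZFinite-act : ∀ {α β q} x → act A P (just α) x ≡ just β → Positive q →
                ZFinite A P α q → ZFinite A P β q
  ZFinite-act {α} {q = q} x αx≡β q>0 (B , Zα≤B) = (1/ weight q x) * B , λ ys distinct inM →
    *-≤⇒≤-1/*ˡ (weight q x) (subst (_≤ B) (sum-weights-++ q x ys)
      (Zα≤B (map (x ++_) ys)
            (AllPairs.map⁺ (AllPairs.map (λ y≁y′ → y≁y′ ∘ ++-cancelˡ-~ A x) distinct))
            (All.map⁺ (All.map (InM-++ x αx≡β) inM))))
    where
    instance
      wx>0 : Positive (weight q x)
      wx>0 = subst Positive (sym (^ℚ≡^ q (length x))) (^-pos (length x) q>0)
      wx≢0 : NonZero (weight q x)
      wx≢0 = ℚ.pos⇒nonZero (weight q x)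

lemma3 : (A : IndepAlphabet) (n : ℕ) (P : PartialAction A n) (α β : Fin n) →
         _⇒_ A P α β → RadiusLe A P α β
lemma3 A n P α β (x , _ , αx≡β) p q 0≤p p<q Zα =
  ZFinite-antimono A P 0≤p (ℚ.<⇒≤ p<q)
    (ZFinite-act A P x αx≡β (positive (ℚ.≤-<-trans 0≤p p<q)) Zα)
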